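{- A graph $G$ is full, i.e. satisfies $d(G)=\delta(G)+1$, if and only if $G\in\Theta$.
   Context: The domatic number $d(G)$ is the maximum number of parts in a partition of $V(G)$ into dominating sets (a set $S$ is dominating if every vertex outside $S$ has a neighbor in $S$); $\delta(G)$ is the minimum degree. The family $\Theta$: let $H_1,\dots,H_r$ be graphs such that at least one of them, say $H_i$, has an isolated vertex $v$. Form $G$ from the disjoint union of $H_1,\dots,H_r$ by (i) joining $v$ to precisely one vertex in each $H_j$ with $j\neq i$, and (ii) adding some edges among the vertices of $\bigcup_{t=1}^r V(H_t)\setminus\{v\}$ such that every vertex of $H_t$ has at least one neighbor in $H_{t'}$ for each $1\leq t\neq t'\leq r$. $\Theta$ is the family of all graphs $G$ obtained this way. -}

module Defs where

open import Data.Nat using (ℕ; suc; _≤_)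
open import Data.Fin using (Fin)
open import Data.Bool using (Bool; true; false; if_then_else_)
open import Data.List using (List; map; allFin)
open import Data.Nat.ListAction using (sum)
open import Data.Product using (Σ; ∃; _×_; _,_)
open import Relation.Binary.PropositionalEquality using (_≡_; _≢_)

record Graph (n : ℕ) : Set where
  field
    Adj   : Fin n → Fin n → Bool
    sym   : ∀ x y → Adj x y ≡ Adj y x
    irrefl : ∀ x → Adj x x ≡ false

open Graph public

module _ {n : ℕ} (G : Graph n) where

  degree : Fin n → ℕ
  degree x = sum (map (λ y → if Adj G x y then 1 else 0) (allFin n))

  IsMinDegree : ℕ → Set
  IsMinDegree δ = (∃ λ x → degree x ≡ δ) × (∀ x → δ ≤ degree x)

  IsDomaticPartition : (k : ℕ) → (Fin n → Fin k) → Set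
  IsDomaticPartition k f =
    ∀ (j : Fin k) (x : Fin n) → f x ≢ j → ∃ λ y → f y ≡ j × Adj G x y ≡ true

  HasDomaticPartition : ℕ → Set
  HasDomaticPartition k = Σ (Fin n → Fin k) (IsDomaticPartition k)

  IsDomaticNumber : ℕ → Set
  IsDomaticNumber d = HasDomaticPartition d × (∀ k → HasDomaticPartition k → k ≤ d)

  Full : Set
  Full = ∃ λ δ → IsMinDegree δ × IsDomaticNumber (suc δ)

  -- The vertex set of G is the disjoint union of V(H_1),…,V(H_r);
  -- c x is the index t with x ∈ V(H_t).  H_t is an arbitrary graph, so the
  -- edges inside each V(H_t) are unconstrained.  The vertex v lies in H_i
  -- (i = c v) and is isolated in H_i; the only edges of G at v are the joins
  -- of step (i): exactly one neighbour in each H_j, j ≠ i (the edges of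
  -- step (ii) avoid v).  Step (ii): every vertex of H_t has a neighbour in
  -- H_t' for every t' ≠ t.
  InΘ : Set
  InΘ = Σ ℕ λ r → Σ (Fin n → Fin r) λ c → Σ (Fin n) λ v →
      (∀ y → c y ≡ c v → Adj G v y ≡ false)
    × (∀ (j : Fin r) → j ≢ c v →
         ∃ λ w → c w ≡ j × Adj G v w ≡ true
               × (∀ y → c y ≡ j → Adj G v y ≡ true → y ≡ w))
    × (∀ (x : Fin n) (t′ : Fin r) → t′ ≢ c x →
         ∃ λ y → c y ≡ t′ × Adj G x y ≡ true)

-- Split the neighbourhood of a vertex x along the classes of a domatic partition into k
-- classes: x has a neighbour in each of the k − 1 classes other than its own, so
-- deg x ≥ k − 1 and hence d(G) ≤ δ(G) + 1.  If d(G) = δ(G) + 1, a vertex of minimum degree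
-- meets these k − 1 lower bounds with equality: it has no neighbour in its own class and
-- exactly one in every other class, so G ∈ Θ with the classes as the H_t.  Conversely, for
-- G ∈ Θ the partition into the V(H_t) is domatic by (ii), while v has degree exactly r − 1,
-- which forces δ(G) = r − 1 and d(G) = r.
module Submission where

open import Defs hiding (sym)
open import Data.Nat using (ℕ; zero; suc; _+_; _≤_; z≤n; s≤s)
open import Data.Nat.Properties
  using (≤-trans; ≤-reflexive; ≤-antisym; +-mono-≤; +-monoʳ-≤; +-monoˡ-≤; m≤n+m;
         +-cancelˡ-≤; +-cancelʳ-≤; +-cancelˡ-≡; 1+n≰n; +-0-commutativeMonoid; module ≤-Reasoning)
open import Data.Fin using (Fin; zero; suc)
open import Data.Fin.Properties using (_≟_; suc-injective)
open import Data.Bool using (Bool; true; false; _∧_; not; if_then_else_)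
open import Data.Bool.Properties using (∧-identityʳ; ∧-zeroʳ)
open import Data.List using (allFin; tabulate)
open import Data.List.Properties using (map-tabulate)
open import Data.List.Relation.Unary.All as All using ()
open import Data.List.Membership.Propositional.Properties using (∈-allFin)
open import Data.List.Extrema.Nat using (argmin; f[argmin]≤f[xs])
open import Data.Nat.ListAction using (sum)
open import Data.Product using (∃; _×_; _,_)
open import Data.Empty using (⊥-elim)
open import Relation.Binary.PropositionalEquality
open import Relation.Nullary using (yes; no; does)
open import Relation.Nullary.Decidable using (dec-true; dec-false)
open import Function.Bundles using (_⇔_; mk⇔)
open import Algebra.Properties.CommutativeMonoid.Sum +-0-commutativeMonoid
  using (sum-syntax; sum-cong-≗; ∑-distrib-+; ∑-comm)
  renaming (sum to ∑)

∑-mono-≤ : ∀ {n} {f g : Fin n → ℕ} → (∀ j → f j ≤ g j) → ∑[ j < n ] f j ≤ ∑[ j < n ] g j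
∑-mono-≤ {zero}  f≤g = z≤n
∑-mono-≤ {suc n} f≤g = +-mono-≤ (f≤g zero) (∑-mono-≤ (λ j → f≤g (suc j)))

∑-mono-≤-tight : ∀ {n} {f g : Fin n → ℕ} → (∀ j → f j ≤ g j) →
                 ∑[ j < n ] g j ≤ ∑[ j < n ] f j → ∀ j → g j ≤ f j
∑-mono-≤-tight {suc n} {f} f≤g ∑g≤∑f zero =
  +-cancelʳ-≤ _ _ _ (≤-trans ∑g≤∑f (+-monoʳ-≤ (f zero) (∑-mono-≤ (λ j → f≤g (suc j)))))
∑-mono-≤-tight {suc n} f≤g ∑g≤∑f (suc j) =
  ∑-mono-≤-tight (λ j → f≤g (suc j))
    (+-cancelˡ-≤ _ _ _ (≤-trans ∑g≤∑f (+-monoˡ-≤ _ (f≤g zero)))) j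

sum-tabulate : ∀ {n} (g : Fin n → ℕ) → sum (tabulate g) ≡ ∑[ j < n ] g j
sum-tabulate {zero}  g = refl
sum-tabulate {suc n} g = cong (g zero +_) (sum-tabulate (λ j → g (suc j)))

𝟙 : Bool → ℕ
𝟙 b = if b then 1 else 0

count : ∀ {n} → (Fin n → Bool) → ℕ
count {n} P = ∑[ y < n ] 𝟙 (P y)

count-true : ∀ n → count (λ (_ : Fin n) → true) ≡ n
count-true zero    = refl
count-true (suc n) = cong suc (count-true n)

count-false : ∀ {n} {P : Fin n → Bool} → (∀ y → P y ≡ false) → count P ≡ 0
count-false {zero}  _ = refl
count-false {suc n} {P} P≡false rewrite P≡false zero =
  count-false {P = λ y → P (suc y)} (λ y → P≡false (suc y))

count-not : ∀ {n} (P : Fin n → Bool) → count P + count (λ y → not (P y)) ≡ n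
count-not {n} P = begin
  count P + count (λ y → not (P y))        ≡⟨ ∑-distrib-+ (λ y → 𝟙 (P y)) (λ y → 𝟙 (not (P y))) ⟨
  ∑[ y < n ] (𝟙 (P y) + 𝟙 (not (P y)))     ≡⟨ sum-cong-≗ (λ y → 𝟙-split (P y)) ⟩
  count {n} (λ _ → true)                   ≡⟨ count-true n ⟩
  n                                        ∎
  where
  open ≡-Reasoning
  𝟙-split : ∀ b → 𝟙 b + 𝟙 (not b) ≡ 1
  𝟙-split true  = refl
  𝟙-split false = refl

true⇒1≤count : ∀ {n} {P : Fin n → Bool} {y} → P y ≡ true → 1 ≤ count P
true⇒1≤count {suc n} {P} {zero}  Py rewrite Py = s≤s z≤n
true⇒1≤count {suc n} {P} {suc y} Py =
  ≤-trans (true⇒1≤count {P = λ y → P (suc y)} Py) (m≤n+m _ (𝟙 (P zero)))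

count≤1⇒unique : ∀ {n} {P : Fin n → Bool} {y w} →
                 count P ≤ 1 → P y ≡ true → P w ≡ true → y ≡ w
count≤1⇒unique {suc n} {P} {zero}  {zero}  _ _ _ = refl
count≤1⇒unique {suc n} {P} {zero}  {suc w} c≤1 Py Pw rewrite Py =
  ⊥-elim (1+n≰n (≤-trans (s≤s (true⇒1≤count {P = λ y → P (suc y)} Pw)) c≤1))
count≤1⇒unique {suc n} {P} {suc y} {zero}  c≤1 Py Pw rewrite Pw =
  ⊥-elim (1+n≰n (≤-trans (s≤s (true⇒1≤count {P = λ y → P (suc y)} Py)) c≤1))
count≤1⇒unique {suc n} {P} {suc y} {suc w} c≤1 Py Pw =
  cong suc (count≤1⇒unique {P = λ y → P (suc y)} (≤-trans (m≤n+m _ (𝟙 (P zero))) c≤1) Py Pw)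

unique⇒count≡1 : ∀ {n} {P : Fin n → Bool} {w} →
                 P w ≡ true → (∀ y → P y ≡ true → y ≡ w) → count P ≡ 1
unique⇒count≡1 {suc n} {P} {zero} Pw unique rewrite Pw =
  cong suc (count-false {P = λ y → P (suc y)} λ y → only-zero (P (suc y)) (unique (suc y)))
  where
  only-zero : ∀ {y : Fin n} b → (b ≡ true → suc y ≡ zero) → b ≡ false
  only-zero true  ≡zero with () ← ≡zero refl
  only-zero false _     = refl
unique⇒count≡1 {suc n} {P} {suc w} Pw unique with P zero in P0
... | true  with () ← unique zero P0
... | false = unique⇒count≡1 {P = λ y → P (suc y)} Pw (λ y Py → suc-injective (unique (suc y) Py))

count-≟ : ∀ {k} (z : Fin k) → count (λ j → does (z ≟ j)) ≡ 1
count-≟ z = unique⇒count≡1 (dec-true (z ≟ z) refl) (λ j z≟j → sym (≟-true⇒≡ z≟j))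
  where
  ≟-true⇒≡ : ∀ {j} → does (z ≟ j) ≡ true → z ≡ j
  ≟-true⇒≡ {j} _ with z ≟ j
  ... | yes z≡j = z≡j

count-≢ : ∀ {k} (z : Fin (suc k)) → count (λ j → not (does (z ≟ j))) ≡ k
count-≢ {k} z = +-cancelˡ-≡ 1 _ _ (begin
  1 + others                           ≡⟨ cong (_+ others) (count-≟ z) ⟨
  count (λ j → does (z ≟ j)) + others  ≡⟨ count-not (λ j → does (z ≟ j)) ⟩
  suc k                                ∎)
  where
  open ≡-Reasoning
  others = count (λ j → not (does (z ≟ j)))

count-partition : ∀ {n k} (P : Fin n → Bool) (f : Fin n → Fin k) →
                  count P ≡ ∑[ j < k ] count (λ y → P y ∧ does (f y ≟ j))
count-partition {n} {k} P f = begin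
  ∑[ y < n ] 𝟙 (P y)                                ≡⟨ sum-cong-≗ (λ y → 𝟙-by-class (P y) (f y)) ⟩
  ∑[ y < n ] ∑[ j < k ] 𝟙 (P y ∧ does (f y ≟ j))    ≡⟨ ∑-comm (λ y j → 𝟙 (P y ∧ does (f y ≟ j))) ⟩
  ∑[ j < k ] ∑[ y < n ] 𝟙 (P y ∧ does (f y ≟ j))    ∎
  where
  open ≡-Reasoning
  𝟙-by-class : ∀ b (z : Fin k) → 𝟙 b ≡ ∑[ j < k ] 𝟙 (b ∧ does (z ≟ j))
  𝟙-by-class true  z = sym (count-≟ z)
  𝟙-by-class false z = sym (count-false {P = λ (_ : Fin k) → false} (λ _ → refl))

module _ {n : ℕ} (G : Graph n) where

  neighboursIn : ∀ {k} → (Fin n → Fin k) → Fin n → Fin k → ℕ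
  neighboursIn f x j = count (λ y → Adj G x y ∧ does (f y ≟ j))

  degree-partition : ∀ {k} (f : Fin n → Fin k) x →
                     degree G x ≡ ∑[ j < k ] neighboursIn f x j
  degree-partition {k} f x = begin
    degree G x                            ≡⟨ cong sum (map-tabulate (λ y → y) (λ y → 𝟙 (Adj G x y))) ⟩
    sum (tabulate (λ y → 𝟙 (Adj G x y)))  ≡⟨ sum-tabulate (λ y → 𝟙 (Adj G x y)) ⟩
    count (Adj G x)                       ≡⟨ count-partition (Adj G x) f ⟩
    ∑[ j < k ] neighboursIn f x j         ∎
    where open ≡-Reasoning

  adjacent⇒1≤neighboursIn : ∀ {k} {f : Fin n → Fin k} {x y j} →
                            f y ≡ j → Adj G x y ≡ true → 1 ≤ neighboursIn f x j
  adjacent⇒1≤neighboursIn {f = f} {x} {y} {j} fy≡j xy =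
    true⇒1≤count {P = λ y → Adj G x y ∧ does (f y ≟ j)} (cong₂ _∧_ xy (dec-true (f y ≟ j) fy≡j))

  domatic⇒neighboursIn : ∀ {k} {f : Fin n → Fin k} → IsDomaticPartition G k f →
                         ∀ x j → 𝟙 (not (does (f x ≟ j))) ≤ neighboursIn f x j
  domatic⇒neighboursIn {f = f} dom x j with f x ≟ j
  ... | yes _    = z≤n
  ... | no fx≢j with y , fy≡j , xy ← dom j x fx≢j = adjacent⇒1≤neighboursIn {f = f} fy≡j xy

  domatic⇒≤degree : ∀ {k} {f : Fin n → Fin (suc k)} → IsDomaticPartition G (suc k) f →
                    ∀ x → k ≤ degree G x
  domatic⇒≤degree {k} {f} dom x = begin
    k                                        ≡⟨ count-≢ (f x) ⟨
    count (λ j → not (does (f x ≟ j)))       ≤⟨ ∑-mono-≤ (domatic⇒neighboursIn dom x) ⟩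
    ∑[ j < suc k ] neighboursIn f x j        ≡⟨ degree-partition f x ⟨
    degree G x                               ∎
    where open ≤-Reasoning

  domatic⇒≤suc-degree : ∀ {k} → HasDomaticPartition G k → ∀ x → k ≤ suc (degree G x)
  domatic⇒≤suc-degree {zero}  _           x = z≤n
  domatic⇒≤suc-degree {suc k} (f , dom) x = s≤s (domatic⇒≤degree dom x)

  module _ {δ} {f : Fin n → Fin (suc δ)} (dom : IsDomaticPartition G (suc δ) f)
           {x} (degx≡δ : degree G x ≡ δ) where

    tight-neighboursIn : ∀ j → neighboursIn f x j ≤ 𝟙 (not (does (f x ≟ j)))
    tight-neighboursIn = ∑-mono-≤-tight (domatic⇒neighboursIn dom x) (≤-reflexive (begin
      ∑[ j < suc δ ] neighboursIn f x j   ≡⟨ degree-partition f x ⟨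
      degree G x                          ≡⟨ degx≡δ ⟩
      δ                                   ≡⟨ count-≢ (f x) ⟨
      count (λ j → not (does (f x ≟ j)))  ∎))
      where open ≡-Reasoning

    tight⇒own-class-non-adjacent : ∀ y → f y ≡ f x → Adj G x y ≡ false
    tight⇒own-class-non-adjacent y fy≡fx with Adj G x y in xy
    ... | false = refl
    ... | true  = ⊥-elim (1+n≰n (≤-trans (adjacent⇒1≤neighboursIn {f = f} fy≡fx xy) own≤0))
      where
      own≤0 : neighboursIn f x (f x) ≤ 0
      own≤0 = subst (λ b → neighboursIn f x (f x) ≤ 𝟙 (not b))
                    (dec-true (f x ≟ f x) refl) (tight-neighboursIn (f x))

    tight⇒unique-neighbour : ∀ j → j ≢ f x → ∃ λ w → f w ≡ j × Adj G x w ≡ true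
                               × (∀ y → f y ≡ j → Adj G x y ≡ true → y ≡ w)
    tight⇒unique-neighbour j j≢fx with w , fw≡j , xw ← dom j x (≢-sym j≢fx) =
      w , fw≡j , xw , λ y fy≡j xy →
        count≤1⇒unique {P = λ y → Adj G x y ∧ does (f y ≟ j)} at-most-one
          (cong₂ _∧_ xy (dec-true (f y ≟ j) fy≡j)) (cong₂ _∧_ xw (dec-true (f w ≟ j) fw≡j))
      where
      at-most-one : neighboursIn f x j ≤ 1
      at-most-one = subst (λ b → neighboursIn f x j ≤ 𝟙 (not b))
                   (dec-false (f x ≟ j) (≢-sym j≢fx)) (tight-neighboursIn j)

    tight⇒InΘ : InΘ G
    tight⇒InΘ = suc δ , f , x , tight⇒own-class-non-adjacent , tight⇒unique-neighbour ,
                λ y j j≢fy → dom j y (≢-sym j≢fy)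

  module _ {r} {c : Fin n → Fin (suc r)} {v}
           (own : ∀ y → c y ≡ c v → Adj G v y ≡ false)
           (others : ∀ j → j ≢ c v → ∃ λ w → c w ≡ j × Adj G v w ≡ true
                                      × (∀ y → c y ≡ j → Adj G v y ≡ true → y ≡ w)) where

    Θ-neighboursIn : ∀ j → neighboursIn c v j ≡ 𝟙 (not (does (c v ≟ j)))
    Θ-neighboursIn j with c v ≟ j
    ... | yes cv≡j = count-false none
      where
      none : ∀ y → (Adj G v y ∧ does (c y ≟ j)) ≡ false
      none y with c y ≟ j
      ... | yes cy≡j = trans (∧-identityʳ _) (own y (trans cy≡j (sym cv≡j)))
      ... | no _     = ∧-zeroʳ _
    ... | no cv≢j with w , cw≡j , vw , unique ← others j (≢-sym cv≢j) =
      unique⇒count≡1 (cong₂ _∧_ vw (dec-true (c w ≟ j) cw≡j)) only-w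
      where
      only-w : ∀ y → (Adj G v y ∧ does (c y ≟ j)) ≡ true → y ≡ w
      only-w y vy∧cy≡j with Adj G v y in vy | c y ≟ j
      ... | true | yes cy≡j = unique y cy≡j vy

    Θ-degree : degree G v ≡ r
    Θ-degree = begin
      degree G v                             ≡⟨ degree-partition c v ⟩
      ∑[ j < suc r ] neighboursIn c v j      ≡⟨ sum-cong-≗ Θ-neighboursIn ⟩
      count (λ j → not (does (c v ≟ j)))     ≡⟨ count-≢ (c v) ⟩
      r                                      ∎
      where open ≡-Reasoning

  min-degree : Fin n → ∃ λ x → ∀ y → degree G x ≤ degree G y
  min-degree v = x₀ , λ y → All.lookup (f[argmin]≤f[xs] v (allFin n)) (∈-allFin y)
    where x₀ = argmin (degree G) v (allFin n)

  domatic∧degree⇒full : ∀ {k} {f : Fin n → Fin (suc k)} → IsDomaticPartition G (suc k) f →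
                        ∀ {v} → degree G v ≡ k → Full G
  domatic∧degree⇒full {k} {f} dom {v} degv≡k with x₀ , x₀-min ← min-degree v =
    degree G x₀ , ((x₀ , refl) , x₀-min) ,
    (subst (λ δ → HasDomaticPartition G (suc δ)) (sym δ≡k) (f , dom)) ,
    (λ k′ k′-domatic → domatic⇒≤suc-degree k′-domatic x₀)
    where
    δ≡k : degree G x₀ ≡ k
    δ≡k = ≤-antisym (≤-trans (x₀-min v) (≤-reflexive degv≡k)) (domatic⇒≤degree dom x₀)

theorem8 : (m : ℕ) (G : Graph (suc m)) → Full G ⇔ InΘ G
theorem8 m G = mk⇔ full⇒Θ Θ⇒full
  where
  full⇒Θ : Full G → InΘ G
  full⇒Θ (δ , ((x , degx≡δ) , _) , ((f , dom) , _)) = tight⇒InΘ G dom degx≡δ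

  Θ⇒full : InΘ G → Full G
  Θ⇒full (zero , c , v , _) with () ← c v
  Θ⇒full (suc r , c , v , own , others , dom) =
    domatic∧degree⇒full G (λ j x cx≢j → dom x j (≢-sym cx≢j)) (Θ-degree G own others)
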